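{- For all integers $\Delta\geq d\geq 1$ and $h\geq0$, the minimum cardinality of an outdegree-$d$ rooted covering of the complete $\Delta$-ary rooted tree of height $h$ equals $\lceil \Delta/d \rceil^{(h)}$, the $h$-fold iterated ceiling defined by $\lceil x\rceil^{(0)}:=1$ and $\lceil x\rceil^{(k)}:=\lceil x\cdot\lceil x\rceil^{(k-1)}\rceil$.
   Context: The complete $\Delta$-ary rooted tree of height $h\geq1$ is the rooted tree in which every non-leaf vertex has outdegree $\Delta$ and every leaf is at distance $h$ from the root; for $h=0$ it is $K_1$. A rooted covering of a rooted tree is a set of subtrees, each containing the root, such that every edge is in at least one subtree. It is outdegree-$d$ if every vertex has outdegree at most $d$ in every subtree of the covering. -}

module Defs where

open import Data.Nat using (ℕ; zero; suc; _+_; _*_; _∸_; _≤_; _<_)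
open import Data.Nat.DivMod using (_/_)
open import Data.Fin using (Fin)
open import Data.Bool using (Bool; true)
open import Data.List using (List; []; _∷_; length; filterᵇ; allFin)
open import Data.Product using (Σ; ∃; ∃-syntax; _×_)
open import Relation.Binary.PropositionalEquality using (_≡_)

-- Vertices of the complete Δ-ary rooted tree of height h are the words
-- w ∈ List (Fin Δ) with length w ≤ h; [] is the root and the children of
-- w are the words i ∷ w (i : Fin Δ).  (Words are read from the vertex up
-- to the root, so the parent of i ∷ w is w.)
Vertex : ℕ → ℕ → Set
Vertex Δ h = Σ (List (Fin Δ)) λ w → length w ≤ h

VSet : ℕ → Set
VSet Δ = List (Fin Δ) → Bool

_∈ᵥ_ : ∀ {Δ} → List (Fin Δ) → VSet Δ → Set
w ∈ᵥ S = S w ≡ true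

record IsRootedSubtree (Δ h : ℕ) (S : VSet Δ) : Set where
  field
    inTree  : ∀ w → w ∈ᵥ S → length w ≤ h
    hasRoot : [] ∈ᵥ S
    closed  : ∀ (i : Fin Δ) w → (i ∷ w) ∈ᵥ S → w ∈ᵥ S

outdeg : ∀ {Δ} → VSet Δ → List (Fin Δ) → ℕ
outdeg {Δ} S w = length (filterᵇ (λ i → S (i ∷ w)) (allFin Δ))

record OutdegCovering (Δ d h k : ℕ) : Set where
  field
    tree      : Fin k → VSet Δ
    nonempty  : 1 ≤ k
    isSubtree : ∀ j → IsRootedSubtree Δ h (tree j)
    covers    : ∀ (w : List (Fin Δ)) (i : Fin Δ) → length w < h →
                ∃[ j ] (w ∈ᵥ tree j × (i ∷ w) ∈ᵥ tree j)
    outdegBd  : ∀ j w → w ∈ᵥ tree j → outdeg (tree j) w ≤ d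

IsMinCoveringSize : ℕ → ℕ → ℕ → ℕ → Set
IsMinCoveringSize Δ d h n =
  OutdegCovering Δ d h n × (∀ k → OutdegCovering Δ d h k → n ≤ k)

-- ⌈Δ/d⌉^(h): iterCeil 0 = 1, iterCeil (k+1) = ⌈(Δ/d)·iterCeil k⌉
--                                          = ⌊(Δ·iterCeil k + d - 1)/d⌋
iterCeil : (Δ d : ℕ) → ℕ → ℕ
iterCeil Δ zero    h       = 1
iterCeil Δ (suc d) zero    = 1
iterCeil Δ (suc d) (suc h) = (Δ * iterCeil Δ (suc d) h + d) / suc d

-- Write D for the outdegree bound d and c j = ⌈Δ/D⌉^(j) = iterCeil Δ D j,
-- so c (j + 1) = ⌈Δ · c j / D⌉.  A vertex w has height h − length w.
--
-- Lower bound (double counting).  Let m(w) be the number of subtrees of a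
-- covering containing the vertex w.  Every subtree containing w contributes
-- at most D edges below w and every edge below w is covered, so
-- Σᵢ m(i ∷ w) ≤ D · m(w).  Since every vertex is covered, m ≥ 1 = c 0 at
-- the leaves, and inductively m(w) ≥ ⌈Δ · c j / D⌉ = c (j + 1) at a vertex
-- of height j + 1; at the root this gives c h ≤ k.
--
-- Upper bound (explicit construction).  Every vertex w of height j gets, in
-- each of the c h subtrees containing it, a label in [0, c j).  The c (j+1)
-- copies of a vertex of height j + 1 have D slots each; slot s of copy u is
-- the number u + s · c (j+1), read as child ⌊·/c j⌋ with label (· mod c j).
-- Since Δ · c j ≤ D · c (j+1) every (child, label) pair is hit, and since
-- c j ≤ c (j+1) distinct slots of one copy serve distinct children.

module Submission where

open import Defs
open import Data.Nat
  using (ℕ; zero; suc; _+_; _*_; _∸_; _≤_; _<_; z≤n; s≤s; s≤s⁻¹; NonZero; >-nonZero; _≡ᵇ_)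
open import Data.Nat.Properties
open import Data.Nat.DivMod
open import Data.Nat.Divisibility using (divides-refl; ∣-refl)
open import Algebra.Properties.Semiring.Sum +-*-semiring
  using (sum; sum-syntax; sum-remove; sum-cong-≗; sum-replicate-zero; ∑-comm; *-distribˡ-sum)
open import Data.Fin using (Fin; toℕ; fromℕ<) renaming (zero to fzero; suc to fsuc)
open import Data.Fin.Properties using (toℕ<n; toℕ-fromℕ<; toℕ-injective; any?)
open import Data.Bool using (Bool; true; false)
open import Data.Bool.Properties using (T-≡)
open import Data.Maybe using (Maybe; just; nothing; is-just; _>>=_)
open import Data.List using (List; []; _∷_; length; filterᵇ; tabulate)
open import Data.Product using (∃; ∃-syntax; _×_; _,_; proj₂)
open import Data.Empty using (⊥-elim)
open import Function using (_∘_; id)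
open import Function.Bundles using (Equivalence)
open import Relation.Nullary using (Dec; yes; no)
open import Relation.Binary.Definitions using (tri<; tri≈; tri>)
open import Relation.Binary.PropositionalEquality

⟦_⟧ : Bool → ℕ
⟦ true ⟧  = 1
⟦ false ⟧ = 0

count : ∀ {n} → (Fin n → Bool) → ℕ
count {n} p = ∑[ i < n ] ⟦ p i ⟧

∑-mono-≤ : ∀ {n} {f g : Fin n → ℕ} → (∀ i → f i ≤ g i) → sum f ≤ sum g
∑-mono-≤ {zero}  f≤g = z≤n
∑-mono-≤ {suc n} f≤g = +-mono-≤ (f≤g fzero) (∑-mono-≤ (f≤g ∘ fsuc))

∑-const : ∀ n x → ∑[ i < n ] x ≡ n * x
∑-const zero    x = refl
∑-const (suc n) x = cong (x +_) (∑-const n x)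

term≤sum : ∀ {n} (f : Fin n → ℕ) i → f i ≤ sum f
term≤sum {suc n} f i = ≤-trans (m≤m+n (f i) _) (≤-reflexive (sym (sum-remove {i = i} f)))

length-filter-tabulate : ∀ {A : Set} {n} (p : A → Bool) (f : Fin n → A) →
  length (filterᵇ p (tabulate f)) ≡ ∑[ i < n ] ⟦ p (f i) ⟧
length-filter-tabulate {n = zero}  p f = refl
length-filter-tabulate {n = suc n} p f with p (f fzero)
... | true  = cong suc (length-filter-tabulate p (f ∘ fsuc))
... | false = length-filter-tabulate p (f ∘ fsuc)

outdeg-count : ∀ {Δ} (S : VSet Δ) w → outdeg S w ≡ count (λ i → S (i ∷ w))
outdeg-count S w = length-filter-tabulate (λ i → S (i ∷ w)) id

count≤size : ∀ {n} (p : Fin n → Bool) → count p ≤ n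
count≤size {n} p = ≤-trans (∑-mono-≤ (λ i → indicator≤1 (p i))) (≤-reflexive (trans (∑-const n 1) (*-identityʳ n)))
  where
  indicator≤1 : ∀ b → ⟦ b ⟧ ≤ 1
  indicator≤1 true  = ≤-refl
  indicator≤1 false = z≤n

count-positive : ∀ {n} (p : Fin n → Bool) i → p i ≡ true → 1 ≤ count p
count-positive p i pi = ≤-trans (≤-reflexive (cong ⟦_⟧ (sym pi))) (term≤sum (λ j → ⟦ p j ⟧) i)

count-none : ∀ {n} (p : Fin n → Bool) → (∀ i → p i ≡ false) → count p ≡ 0
count-none {n} p none = trans (sum-cong-≗ (λ i → cong ⟦_⟧ (none i))) (sum-replicate-zero n)

count-toℕ≡ : ∀ n x → count {n} (λ i → x ≡ᵇ toℕ i) ≤ 1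
count-toℕ≡ zero    x       = z≤n
count-toℕ≡ (suc n) zero    = s≤s (≤-reflexive (count-none {n} _ (λ _ → refl)))
count-toℕ≡ (suc n) (suc x) = count-toℕ≡ n x

count-image : ∀ {n m} (p : Fin n → Bool) (g : Fin m → ℕ) →
  (∀ i → p i ≡ true → ∃[ s ] g s ≡ toℕ i) → count p ≤ m
count-image {n} {m} p g image = begin
  ∑[ i < n ] ⟦ p i ⟧                       ≤⟨ ∑-mono-≤ hit ⟩
  ∑[ i < n ] ∑[ s < m ] ⟦ g s ≡ᵇ toℕ i ⟧  ≡⟨ ∑-comm {n} {m} (λ i s → ⟦ g s ≡ᵇ toℕ i ⟧) ⟩
  ∑[ s < m ] ∑[ i < n ] ⟦ g s ≡ᵇ toℕ i ⟧  ≤⟨ ∑-mono-≤ (λ s → count-toℕ≡ n (g s)) ⟩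
  ∑[ s < m ] 1                             ≡⟨ trans (∑-const m 1) (*-identityʳ m) ⟩
  m                                        ∎
  where
  open ≤-Reasoning
  hit : ∀ i → ⟦ p i ⟧ ≤ ∑[ s < m ] ⟦ g s ≡ᵇ toℕ i ⟧
  hit i with p i in pi
  ... | false = z≤n
  ... | true with image i pi
  ...   | s , gs≡i = ≤-trans (≤-reflexive (cong ⟦_⟧ (sym (Equivalence.to T-≡ (≡⇒≡ᵇ _ _ gs≡i)))))
                             (term≤sum (λ s → ⟦ g s ≡ᵇ toℕ i ⟧) s)

-- (m + d') / suc d' is ⌈m / suc d'⌉: it satisfies m ≤ suc d' · ⌈m / suc d'⌉
ceil-upper : ∀ d' m → m ≤ suc d' * ((m + d') / suc d')
ceil-upper d' m = +-cancelʳ-≤ d' _ _ (begin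
  m + d'                                   ≡⟨ m≡m%n+[m/n]*n (m + d') (suc d') ⟩
  (m + d') % suc d' + q * suc d'           ≤⟨ +-monoˡ-≤ _ (s≤s⁻¹ (m%n<n (m + d') (suc d'))) ⟩
  d' + q * suc d'                          ≡⟨ cong (d' +_) (*-comm q (suc d')) ⟩
  d' + suc d' * q                          ≡⟨ +-comm d' _ ⟩
  suc d' * q + d'                          ∎)
  where
  open ≤-Reasoning
  q = (m + d') / suc d'

ceil-least : ∀ d' m a → m ≤ suc d' * a → (m + d') / suc d' ≤ a
ceil-least d' m a m≤Da = s≤s⁻¹ (m<n*o⇒m/o<n (begin-strict
  m + d'          <⟨ +-monoʳ-< m ≤-refl ⟩
  m + suc d'      ≤⟨ +-monoˡ-≤ (suc d') m≤Da ⟩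
  suc d' * a + suc d' ≡⟨ +-comm (suc d' * a) (suc d') ⟩
  suc d' + suc d' * a ≡⟨ cong (suc d' +_) (*-comm (suc d') a) ⟩
  suc a * suc d'  ∎))
  where open ≤-Reasoning

-- c (j+1) parent copies with D slots each have room for Δ · c j child copies
iterCeil-room : ∀ Δ d' j → Δ * iterCeil Δ (suc d') j ≤ suc d' * iterCeil Δ (suc d') (suc j)
iterCeil-room Δ d' j = ceil-upper d' (Δ * iterCeil Δ (suc d') j)

iterCeil-mono : ∀ {Δ d'} → suc d' ≤ Δ → ∀ j → iterCeil Δ (suc d') j ≤ iterCeil Δ (suc d') (suc j)
iterCeil-mono {Δ} {d'} D≤Δ j = *-cancelˡ-≤ (suc d')
  (≤-trans (*-monoˡ-≤ (iterCeil Δ (suc d') j) D≤Δ) (iterCeil-room Δ d' j))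

iterCeil-positive : ∀ {Δ d'} → suc d' ≤ Δ → ∀ j → 1 ≤ iterCeil Δ (suc d') j
iterCeil-positive D≤Δ zero    = ≤-refl
iterCeil-positive D≤Δ (suc j) = ≤-trans (iterCeil-positive D≤Δ j) (iterCeil-mono D≤Δ j)

module LowerBound {Δ d' h k : ℕ} (𝒞 : OutdegCovering Δ (suc d') h k) where
  open OutdegCovering 𝒞

  multiplicity : List (Fin Δ) → ℕ
  multiplicity w = count (λ t → tree t w)

  -- a subtree missing w contains no child of w (it is closed under parents)
  outdeg-bound : ∀ t w → outdeg (tree t) w ≤ suc d' * ⟦ tree t w ⟧
  outdeg-bound t w with tree t w in w∈t
  ... | true  = subst (outdeg (tree t) w ≤_) (sym (*-identityʳ (suc d'))) (outdegBd t w w∈t)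
  ... | false = ≤-reflexive (trans (outdeg-count (tree t) w)
                                   (trans (count-none _ child∉t) (sym (*-zeroʳ (suc d')))))
    where
    child∉t : ∀ i → tree t (i ∷ w) ≡ false
    child∉t i with tree t (i ∷ w) in i∷w∈t
    ... | false = refl
    ... | true  = trans (sym (IsRootedSubtree.closed (isSubtree t) i w i∷w∈t)) w∈t

  -- double counting the pairs (subtree, edge from w to a child)
  children-bound : ∀ w → ∑[ i < Δ ] multiplicity (i ∷ w) ≤ suc d' * multiplicity w
  children-bound w = begin
    ∑[ i < Δ ] ∑[ t < k ] ⟦ tree t (i ∷ w) ⟧  ≡⟨ ∑-comm (λ i t → ⟦ tree t (i ∷ w) ⟧) ⟩
    ∑[ t < k ] count (λ i → tree t (i ∷ w))   ≡⟨ sum-cong-≗ (λ t → outdeg-count (tree t) w) ⟨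
    ∑[ t < k ] outdeg (tree t) w               ≤⟨ ∑-mono-≤ (λ t → outdeg-bound t w) ⟩
    ∑[ t < k ] (suc d' * ⟦ tree t w ⟧)         ≡⟨ *-distribˡ-sum (suc d') (λ t → ⟦ tree t w ⟧) ⟨
    suc d' * multiplicity w                    ∎
    where open ≤-Reasoning

  -- every vertex lies in some subtree: the root in all, others via an edge
  vertex-covered : ∀ w → length w ≤ h → ∃[ t ] w ∈ᵥ tree t
  vertex-covered []      _     = fromℕ< nonempty , IsRootedSubtree.hasRoot (isSubtree _)
  vertex-covered (i ∷ w) |w|<h with covers w i |w|<h
  ... | t , _ , i∷w∈t = t , i∷w∈t

  multiplicity-bound : ∀ j w → length w + j ≡ h → iterCeil Δ (suc d') j ≤ multiplicity w
  multiplicity-bound zero w leaf with vertex-covered w (≤-reflexive (trans (sym (+-identityʳ _)) leaf))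
  ... | t , w∈t = count-positive _ t w∈t
  multiplicity-bound (suc j) w height = ceil-least d' _ _ (begin
    Δ * iterCeil Δ (suc d') j               ≡⟨ ∑-const Δ _ ⟨
    ∑[ i < Δ ] iterCeil Δ (suc d') j        ≤⟨ ∑-mono-≤ (λ i → multiplicity-bound j (i ∷ w) child-height) ⟩
    ∑[ i < Δ ] multiplicity (i ∷ w)         ≤⟨ children-bound w ⟩
    suc d' * multiplicity w                 ∎)
    where
    open ≤-Reasoning
    child-height : suc (length w) + j ≡ h
    child-height = trans (sym (+-suc (length w) j)) height

  size-bound : iterCeil Δ (suc d') h ≤ k
  size-bound = ≤-trans (multiplicity-bound h [] refl) (count≤size _)

quotient-gap : ∀ x {a b} c C .{{_ : NonZero c}} → c ≤ C → a < b →
  (x + a * C) / c < (x + b * C) / c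
quotient-gap x {a} {b} c C c≤C a<b = begin-strict
  (x + a * C) / c      <⟨ m<m+n _ ≤-refl ⟩
  (x + a * C) / c + 1  ≡⟨ cong ((x + a * C) / c +_) (n/n≡1 c) ⟨
  (x + a * C) / c + c / c ≡⟨ +-distrib-/-∣ʳ (x + a * C) ∣-refl ⟨
  (x + a * C + c) / c  ≤⟨ /-monoˡ-≤ c gap ⟩
  (x + b * C) / c      ∎
  where
  open ≤-Reasoning
  gap : x + a * C + c ≤ x + b * C
  gap = begin
    x + a * C + c      ≡⟨ +-assoc x (a * C) c ⟩
    x + (a * C + c)    ≤⟨ +-monoʳ-≤ x (+-monoʳ-≤ (a * C) c≤C) ⟩
    x + (a * C + C)    ≡⟨ cong (x +_) (+-comm (a * C) C) ⟩
    x + suc a * C      ≤⟨ +-monoʳ-≤ x (*-monoˡ-≤ C a<b) ⟩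
    x + b * C          ∎

-- The children of the C copies of a vertex, each child having c copies.
module Slots (Δ D c C : ℕ) .{{_ : NonZero c}} .{{_ : NonZero C}} where

  -- slot s of copy u, read as child ⌊·/c⌋ with label (· mod c)
  slot : ℕ → Fin D → ℕ
  slot u s = u + toℕ s * C

  hosts? : ∀ u (i : Fin Δ) → Dec (∃[ s ] slot u s / c ≡ toℕ i)
  hosts? u i = any? (λ s → slot u s / c ≟ toℕ i)

  childLabel : ℕ → Fin Δ → Maybe ℕ
  childLabel u i with hosts? u i
  ... | yes (s , _) = just (slot u s % c)
  ... | no _        = nothing

  -- the copy of the parent through which copy u' of child i passes
  parentLabel : Fin Δ → ℕ → ℕ
  parentLabel i u' = (u' + toℕ i * c) % C

  childLabel-hosted : ∀ u i → is-just (childLabel u i) ≡ true → ∃[ s ] slot u s / c ≡ toℕ i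
  childLabel-hosted u i present with hosts? u i
  ... | yes hosted = hosted

  -- each copy has at most D children: one per slot
  childLabel-outdeg : ∀ u → count (λ i → is-just (childLabel u i)) ≤ D
  childLabel-outdeg u = count-image _ (λ s → slot u s / c) (childLabel-hosted u)

  slot-injective : c ≤ C → ∀ {u} s s' → slot u s / c ≡ slot u s' / c → s ≡ s'
  slot-injective c≤C {u} s s' same with <-cmp (toℕ s) (toℕ s')
  ... | tri< s<s' _ _ = ⊥-elim (<⇒≢ (quotient-gap u c C c≤C s<s') same)
  ... | tri≈ _ s≡s' _ = toℕ-injective s≡s'
  ... | tri> _ _ s'<s = ⊥-elim (<⇒≢ (quotient-gap u c C c≤C s'<s) (sym same))

  parentLabel<C : ∀ i u' → parentLabel i u' < C
  parentLabel<C i u' = m%n<n _ C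

  -- copy u' of child i is the number u' + i · c < Δ · c ≤ D · C, which is
  -- slot ⌊·/C⌋ of the parent copy (· mod C)
  hostSlot<D : Δ * c ≤ D * C → ∀ (i : Fin Δ) u' → u' < c → (u' + toℕ i * c) / C < D
  hostSlot<D room i u' u'<c = m<n*o⇒m/o<n (begin-strict
    u' + toℕ i * c  <⟨ +-monoˡ-< (toℕ i * c) u'<c ⟩
    suc (toℕ i) * c ≤⟨ *-monoˡ-≤ c (toℕ<n i) ⟩
    Δ * c           ≤⟨ room ⟩
    D * C           ∎)
    where open ≤-Reasoning

  hostSlot : Δ * c ≤ D * C → ∀ (i : Fin Δ) u' → u' < c → Fin D
  hostSlot room i u' u'<c = fromℕ< (hostSlot<D room i u' u'<c)

  hostSlot-value : ∀ room (i : Fin Δ) u' u'<c → slot (parentLabel i u') (hostSlot room i u' u'<c) ≡ u' + toℕ i * c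
  hostSlot-value room i u' u'<c =
    trans (cong (λ q → parentLabel i u' + q * C) (toℕ-fromℕ< (hostSlot<D room i u' u'<c)))
          (sym (m≡m%n+[m/n]*n (u' + toℕ i * c) C))

  hostSlot-hosts : ∀ room (i : Fin Δ) u' → (u'<c : u' < c) →
    slot (parentLabel i u') (hostSlot room i u' u'<c) / c ≡ toℕ i
  hostSlot-hosts room i u' u'<c = begin
    slot (parentLabel i u') (hostSlot room i u' u'<c) / c ≡⟨ cong (_/ c) (hostSlot-value room i u' u'<c) ⟩
    (u' + toℕ i * c) / c        ≡⟨ +-distrib-/-∣ʳ u' (divides-refl (toℕ i)) ⟩
    u' / c + toℕ i * c / c      ≡⟨ cong₂ _+_ (m<n⇒m/n≡0 u'<c) (m*n/n≡m (toℕ i) c) ⟩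
    toℕ i                       ∎
    where open ≡-Reasoning

  childLabel-complete : c ≤ C → Δ * c ≤ D * C → ∀ i u' → u' < c →
    childLabel (parentLabel i u') i ≡ just u'
  childLabel-complete c≤C room i u' u'<c with hosts? (parentLabel i u') i
  ... | no unhosted  = ⊥-elim (unhosted (hostSlot room i u' u'<c , hostSlot-hosts room i u' u'<c))
  ... | yes (s , e) = cong just (begin
      slot u s % c          ≡⟨ cong (λ x → slot u x % c) (slot-injective c≤C s s₀ (trans e (sym (hostSlot-hosts room i u' u'<c)))) ⟩
      slot u s₀ % c         ≡⟨ cong (_% c) (hostSlot-value room i u' u'<c) ⟩
      (u' + toℕ i * c) % c  ≡⟨ [m+kn]%n≡m%n u' (toℕ i) c ⟩
      u' % c                ≡⟨ m<n⇒m%n≡m u'<c ⟩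
      u'                    ∎)
    where
    open ≡-Reasoning
    u = parentLabel i u'
    s₀ = hostSlot room i u' u'<c

module Construction (Δ d' h : ℕ) (D≤Δ : suc d' ≤ Δ) where

  c : ℕ → ℕ
  c = iterCeil Δ (suc d')

  c-nonZero : ∀ j → NonZero (c j)
  c-nonZero j = >-nonZero (iterCeil-positive D≤Δ j)

  module SlotsAt (j : ℕ) = Slots Δ (suc d') (c j) (c (suc j)) {{c-nonZero j}} {{c-nonZero (suc j)}}

  childLabel : ℕ → ℕ → Fin Δ → Maybe ℕ
  childLabel zero    u i = nothing
  childLabel (suc j) u i = SlotsAt.childLabel j u i

  label : ℕ → List (Fin Δ) → Maybe ℕ
  label t []      = just t
  label t (i ∷ w) = label t w >>= λ u → childLabel (h ∸ length w) u i

  subtree : Fin (c h) → VSet Δ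
  subtree t w = is-just (label (toℕ t) w)

  -- subtrees are closed under parents: a child is labelled via its parent
  label-parent : ∀ t i w → is-just (label t (i ∷ w)) ≡ true → is-just (label t w) ≡ true
  label-parent t i w present with label t w
  ... | just _ = refl

  -- only vertices of depth ≤ h are labelled: leaves have no children
  label-depth : ∀ t w → is-just (label t w) ≡ true → length w ≤ h
  label-depth t []      _       = z≤n
  label-depth t (i ∷ w) present with label t w
  ... | just u with h ∸ length w in height
  ...   | suc _ = m∸n≢0⇒n<m (λ h∸|w|≡0 → 0≢1+n (trans (sym h∸|w|≡0) height))

  childLabel-outdeg : ∀ r u → count (λ i → is-just (childLabel r u i)) ≤ suc d'
  childLabel-outdeg zero    u = ≤-trans (≤-reflexive (count-none {Δ} _ (λ _ → refl))) z≤n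
  childLabel-outdeg (suc j) u = SlotsAt.childLabel-outdeg j u

  label-outdeg : ∀ t w u → label t w ≡ just u → outdeg (λ v → is-just (label t v)) w ≤ suc d'
  label-outdeg t w u labelled = begin
    outdeg (λ v → is-just (label t v)) w                  ≡⟨ outdeg-count (λ v → is-just (label t v)) w ⟩
    count (λ i → is-just (label t (i ∷ w)))               ≡⟨ sum-cong-≗ (λ i → cong ⟦_⟧ (child-present i)) ⟩
    count (λ i → is-just (childLabel (h ∸ length w) u i)) ≤⟨ childLabel-outdeg (h ∸ length w) u ⟩
    suc d'                                                ∎
    where
    open ≤-Reasoning
    child-present : ∀ i → is-just (label t (i ∷ w)) ≡ is-just (childLabel (h ∸ length w) u i)
    child-present i = cong (λ m → is-just (m >>= λ v → childLabel (h ∸ length w) v i)) labelled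

  remaining-height : ∀ (w : List (Fin Δ)) j → length w + j ≡ h → h ∸ length w ≡ j
  remaining-height w j height = trans (cong (_∸ length w) (sym height)) (m+n∸m≡n (length w) j)

  parent-height : ∀ {i : Fin Δ} w j → length (i ∷ w) + j ≡ h → length w + suc j ≡ h
  parent-height w j height = trans (+-suc (length w) j) height

  label-surjective : ∀ j w → length w + j ≡ h → ∀ u → u < c j →
    ∃ λ (t : Fin (c h)) → label (toℕ t) w ≡ just u
  label-surjective j []      j≡h u u<c = fromℕ< (subst (λ x → u < c x) j≡h u<c) , cong just (toℕ-fromℕ< _)
  label-surjective j (i ∷ w) height u u<c
    with label-surjective (suc j) w (parent-height {i} w j height) (SlotsAt.parentLabel j i u)
                                                                (SlotsAt.parentLabel<C j i u)
  ... | t , labelled = t , (begin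
    (label (toℕ t) w >>= λ v → childLabel (h ∸ length w) v i)
      ≡⟨ cong (λ m → m >>= λ v → childLabel (h ∸ length w) v i) labelled ⟩
    childLabel (h ∸ length w) (SlotsAt.parentLabel j i u) i
      ≡⟨ cong (λ r → childLabel r (SlotsAt.parentLabel j i u) i) (remaining-height w (suc j) (parent-height {i} w j height)) ⟩
    SlotsAt.childLabel j (SlotsAt.parentLabel j i u) i
      ≡⟨ SlotsAt.childLabel-complete j (iterCeil-mono D≤Δ j) (iterCeil-room Δ d' j) i u u<c ⟩
    just u ∎)
    where open ≡-Reasoning

  is-just⇒just : ∀ {m : Maybe ℕ} → is-just m ≡ true → ∃[ x ] m ≡ just x
  is-just⇒just {m = just x} _ = x , refl

  covering : OutdegCovering Δ (suc d') h (c h)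
  covering = record
    { tree      = subtree
    ; nonempty  = iterCeil-positive D≤Δ h
    ; isSubtree = λ t → record
        { inTree  = label-depth (toℕ t)
        ; hasRoot = refl
        ; closed  = label-parent (toℕ t) }
    ; covers    = edge-covered
    ; outdegBd  = λ t w present → label-outdeg (toℕ t) w _ (proj₂ (is-just⇒just present)) }
    where
    edge-covered : ∀ w i → length w < h → ∃[ t ] (w ∈ᵥ subtree t × (i ∷ w) ∈ᵥ subtree t)
    edge-covered w i |w|<h with label-surjective (h ∸ suc (length w)) (i ∷ w) (m+[n∸m]≡n |w|<h) 0
                                                 (iterCeil-positive D≤Δ (h ∸ suc (length w)))
    ... | t , labelled = t , label-parent (toℕ t) i w child∈t , child∈t
      where
      child∈t : (i ∷ w) ∈ᵥ subtree t
      child∈t = cong is-just labelled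

mainTheorem13 : (Δ d h : ℕ) → 1 ≤ d → d ≤ Δ →
    IsMinCoveringSize Δ d h (iterCeil Δ d h)
mainTheorem13 Δ (suc d') h _ D≤Δ =
  Construction.covering Δ d' h D≤Δ , λ k 𝒞 → LowerBound.size-bound 𝒞
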